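{- Let $M=(E,r)$ be a $q$-matroid and let $C_1,\dots,C_\ell$ be cyclic subspaces of $E$. Then $C_1+\cdots+C_\ell$ is cyclic.
   Context: Let $q$ be a prime power and $E$ an $n$-dimensional $\mathbb{F}_q$-vector space. A $q$-matroid $(E,r)$ is a function $r$ from subspaces of $E$ to $\mathbb{Z}$ with (R1) $0\le r(A)\le\dim A$, (R2) $r(A)\le r(B)$ if $A\le B$, (R3) $r(A+B)+r(A\cap B)\le r(A)+r(B)$. A subspace $A\le E$ is cyclic if $r(B)=r(A)$ for every subspace $B\le A$ of codimension $1$ in $A$. -}

module Defs where

open import Data.Nat using (ℕ; zero; suc; _≤_; _+_; _^_)
open import Data.Nat.Primality using (Prime)
open import Data.Fin using (Fin)
import Data.Fin as Fin
open import Data.Product using (Σ; _×_; _,_)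
open import Relation.Binary.PropositionalEquality using (_≡_; _≢_)
open import Relation.Nullary using (Dec)
open import Algebra.Structures using (IsCommutativeRing)
open import Function.Bundles using (_↔_; _⇔_)

IsPrimePower : ℕ → Set
IsPrimePower q = Σ ℕ λ p → Σ ℕ λ k → Prime p × q ≡ p ^ suc k

record FiniteField (q : ℕ) : Set₁ where
  infixl 6 _+F_
  infixl 7 _*F_
  field
    Carrier : Set
    _+F_ _*F_ : Carrier → Carrier → Carrier
    -F_     : Carrier → Carrier
    0# 1#   : Carrier
    isCommutativeRing : IsCommutativeRing _≡_ _+F_ _*F_ -F_ 0# 1#
    0≢1     : 0# ≢ 1#
    inverse : ∀ x → x ≢ 0# → Σ Carrier λ y → x *F y ≡ 1#
    enum    : Carrier ↔ Fin q

module Space {q : ℕ} (𝔽 : FiniteField q) (n : ℕ) where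
  open FiniteField 𝔽

  V : Set
  V = Fin n → Carrier

  _≈V_ : V → V → Set
  u ≈V v = ∀ i → u i ≡ v i

  zeroV : V
  zeroV _ = 0#

  _⊕_ : V → V → V
  (u ⊕ v) i = u i +F v i

  _·_ : Carrier → V → V
  (c · v) i = c *F v i

  record Subspace : Set₁ where
    field
      _∋_   : V → Set
      ∋?    : ∀ v → Dec (_∋_ v)
      ∋-resp : ∀ {u v} → u ≈V v → _∋_ u → _∋_ v
      ∋zero : _∋_ zeroV
      ∋⊕    : ∀ {u v} → _∋_ u → _∋_ v → _∋_ (u ⊕ v)
      ∋·    : ∀ c {v} → _∋_ v → _∋_ (c · v)
  open Subspace public

  _≤S_ : Subspace → Subspace → Set
  A ≤S B = ∀ v → A ∋ v → B ∋ v

  lincomb : ∀ {k} → (Fin k → Carrier) → (Fin k → V) → V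
  lincomb {zero}  c b = zeroV
  lincomb {suc k} c b = (c Fin.zero · b Fin.zero) ⊕ lincomb (λ j → c (Fin.suc j)) (λ j → b (Fin.suc j))

  sumV : ∀ {ℓ} → (Fin ℓ → V) → V
  sumV {zero}  w = zeroV
  sumV {suc ℓ} w = w Fin.zero ⊕ sumV (λ j → w (Fin.suc j))

  LinIndep : ∀ {k} → (Fin k → V) → Set
  LinIndep b = ∀ c → lincomb c b ≈V zeroV → ∀ j → c j ≡ 0#

  IsBasis : ∀ {k} → Subspace → (Fin k → V) → Set
  IsBasis A b = (∀ j → A ∋ b j) × LinIndep b
              × (∀ v → A ∋ v → Σ (Fin _ → Carrier) λ c → v ≈V lincomb c b)

  HasDim : Subspace → ℕ → Set
  HasDim A k = Σ (Fin k → V) λ b → IsBasis A b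

  IsSum₂ : Subspace → Subspace → Subspace → Set
  IsSum₂ S A B = ∀ v → S ∋ v ⇔ Σ V λ a → Σ V λ b → A ∋ a × B ∋ b × v ≈V (a ⊕ b)

  IsMeet : Subspace → Subspace → Subspace → Set
  IsMeet I A B = ∀ v → I ∋ v ⇔ (A ∋ v × B ∋ v)

  IsSum : ∀ {ℓ} → Subspace → (Fin ℓ → Subspace) → Set
  IsSum {ℓ} S C = ∀ v → S ∋ v ⇔
    Σ (Fin ℓ → V) λ w → (∀ i → C i ∋ w i) × v ≈V sumV w

  record QMatroid : Set₁ where
    field
      r  : Subspace → ℕ
      -- (R1) 0 ≤ r(A) ≤ dim A   (0 ≤ r(A) is automatic since r is ℕ-valued)
      R1 : ∀ A k → HasDim A k → r A ≤ k
      R2 : ∀ A B → A ≤S B → r A ≤ r B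
      R3 : ∀ A B S I → IsSum₂ S A B → IsMeet I A B → r S + r I ≤ r A + r B

  Cyclic : QMatroid → Subspace → Set₁
  Cyclic M A = ∀ B → B ≤S A → ∀ k → HasDim A (suc k) → HasDim B k →
               QMatroid.r M B ≡ QMatroid.r M A

-- Let B be a hyperplane of S = C₁ + ⋯ + C_ℓ. A basis vector of S outside B has a summand
-- c ∈ Cᵢ outside B, so S = ⟨c⟩ + B = Cᵢ + B and Cᵢ ∩ B is a hyperplane of Cᵢ. Cyclicity of Cᵢ
-- gives r(Cᵢ ∩ B) = r(Cᵢ), and then (R3) r(S) + r(Cᵢ ∩ B) ≤ r(Cᵢ) + r(B) yields r(S) ≤ r(B).
-- The dimension counting rests on the Steinitz exchange lemma; subspaces have bases because,
-- over a finite field, membership in a span is decidable.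

module Submission where

open import Defs
open import Data.Nat using (ℕ; zero; suc; _≤_; _<_; s≤s; _+_)
open import Data.Nat.Properties using (≤-antisym; +-comm; +-cancelˡ-≤; n<1+n; m<n⇒m<1+n; module ≤-Reasoning)
open import Data.Fin using (Fin; punchIn) renaming (zero to fzero; suc to fsuc)
import Data.Fin as Fin
open import Data.Fin.Properties using (any?; all?; ¬∀⟶∃¬)
open import Data.Vec.Functional using (_∷_; tail; insertAt)
open import Data.Vec.Functional.Properties using (insertAt-lookup; insertAt-punchIn)
open import Data.Product using (Σ; _×_; _,_; proj₁; proj₂)
open import Data.Empty using (⊥-elim)
open import Relation.Nullary using (Dec; yes; no; ¬_)
open import Relation.Nullary.Decidable using (map′; via-injection; decidable-stable; ¬?; _×-dec_)
open import Relation.Binary.Definitions using (DecidableEquality)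
open import Relation.Binary.PropositionalEquality
open import Function using (_∘_; id)
open import Function.Bundles using (Inverse; Equivalence; mk⇔)
open import Function.Properties.Inverse using (↔⇒↣)
open import Algebra.Bundles using (CommutativeRing)

module FieldProperties {q : ℕ} (𝔽 : FiniteField q) where
  open FiniteField 𝔽
  open Inverse enum using (to; from; strictlyInverseʳ)

  commutativeRing : CommutativeRing _ _
  commutativeRing = record { isCommutativeRing = isCommutativeRing }

  open CommutativeRing commutativeRing
    using (commutativeSemiring; ring; +-assoc; *-identityˡ; *-identityʳ; -‿inverseʳ)
  open import Algebra.Properties.Ring ring
    using (-‿distribˡ-*; -‿distribʳ-*; -‿involutive; +-inverseʳ-unique; xyx⁻¹≈y)
  open import Algebra.Solver.Ring.NaturalCoefficients.Default commutativeSemiring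
  open ≡-Reasoning

  _≟_ : DecidableEquality Carrier
  _≟_ = via-injection (↔⇒↣ enum) Fin._≟_

  anyScalar? : (P : Carrier → Set) → (∀ a → Dec (P a)) → Dec (Σ Carrier P)
  anyScalar? P P? = map′ (λ (i , p) → from i , p)
                         (λ (a , p) → to a , subst P (sym (strictlyInverseʳ a)) p)
                         (any? (P? ∘ from))

  -- Pointwise equal functions need not be equal, hence the invariance hypothesis.
  anyVector? : ∀ m (P : (Fin m → Carrier) → Set) → (∀ {f g} → (∀ i → f i ≡ g i) → P f → P g) →
               (∀ f → Dec (P f)) → Dec (Σ (Fin m → Carrier) P)
  anyVector? zero P P-resp P? =
    map′ (λ p → _ , p) (λ (f , p) → P-resp (λ ()) p) (P? (λ ()))
  anyVector? (suc m) P P-resp P? =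
    map′ (λ (a , f , p) → a ∷ f , p)
         (λ (f , p) → f fzero , tail f , P-resp (λ { fzero → refl ; (fsuc i) → refl }) p)
         (anyScalar? _ λ a → anyVector? m (λ f → P (a ∷ f))
                                (λ f≗g → P-resp λ { fzero → refl ; (fsuc i) → f≗g i })
                                (λ f → P? (a ∷ f)))

  x≡yz+w⇒w≡x-yz : ∀ {x y z w} → x ≡ y *F z +F w → w ≡ x +F -F y *F z
  x≡yz+w⇒w≡x-yz {x} {y} {z} {w} x≡ = begin
    w                        ≡⟨ sym (xyx⁻¹≈y (y *F z) w) ⟩
    y *F z +F w +F -F (y *F z) ≡⟨ cong (λ u → u +F -F (y *F z)) (sym x≡) ⟩
    x +F -F (y *F z)          ≡⟨ cong (x +F_) (-‿distribˡ-* y z) ⟩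
    x +F -F y *F z            ∎

  x≡yz+[x-yz] : ∀ x y z → x ≡ y *F z +F (x +F -F y *F z)
  x≡yz+[x-yz] x y z = begin
    x                                ≡⟨ sym (xyx⁻¹≈y (y *F z) x) ⟩
    y *F z +F x +F -F (y *F z)       ≡⟨ +-assoc (y *F z) x _ ⟩
    y *F z +F (x +F -F (y *F z))     ≡⟨ cong (λ u → y *F z +F (x +F u)) (-‿distribˡ-* y z) ⟩
    y *F z +F (x +F -F y *F z)       ∎

  ax+t≡0⇒x≡-γt : ∀ {a γ x t} → a *F γ ≡ 1# → a *F x +F t ≡ 0# → x ≡ -F γ *F t
  ax+t≡0⇒x≡-γt {a} {γ} {x} {t} aγ≡1 ax+t≡0 = begin
    x                         ≡⟨ sym (*-identityˡ x) ⟩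
    1# *F x                   ≡⟨ cong (_*F x) (sym aγ≡1) ⟩
    a *F γ *F x               ≡⟨ solve 3 (λ a γ x → a :* γ :* x := γ :* (a :* x)) refl a γ x ⟩
    γ *F (a *F x)             ≡⟨ sym (-‿involutive _) ⟩
    -F -F (γ *F (a *F x))     ≡⟨ cong -F_ (-‿distribʳ-* γ (a *F x)) ⟩
    -F (γ *F -F (a *F x))     ≡⟨ -‿distribˡ-* γ _ ⟩
    -F γ *F -F (a *F x)       ≡⟨ cong (-F γ *F_) (sym (+-inverseʳ-unique (a *F x) t ax+t≡0)) ⟩
    -F γ *F t                 ∎

  a-aβb≡0 : ∀ {a b β} → b *F β ≡ 1# → a +F -F (a *F β) *F b ≡ 0#
  a-aβb≡0 {a} {b} {β} bβ≡1 = begin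
    a +F -F (a *F β) *F b      ≡⟨ cong (a +F_) (sym (-‿distribˡ-* (a *F β) b)) ⟩
    a +F -F (a *F β *F b)      ≡⟨ cong (λ u → a +F -F u) aβb≡a ⟩
    a +F -F a                  ≡⟨ -‿inverseʳ a ⟩
    0#                         ∎
    where
    aβb≡a : a *F β *F b ≡ a
    aβb≡a = begin
      a *F β *F b   ≡⟨ solve 3 (λ a β b → a :* β :* b := a :* (b :* β)) refl a β b ⟩
      a *F (b *F β) ≡⟨ cong (a *F_) bβ≡1 ⟩
      a *F 1#       ≡⟨ *-identityʳ a ⟩
      a             ∎

module LinearAlgebra {q : ℕ} (𝔽 : FiniteField q) (n : ℕ) where
  open FiniteField 𝔽
  open FieldProperties 𝔽
  open Space 𝔽 n
  open CommutativeRing commutativeRing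
    using (commutativeSemiring; +-rawMonoid; zeroˡ; zeroʳ; +-identityˡ; +-identityʳ)
  open import Algebra.Definitions.RawMonoid +-rawMonoid using (sum)
  open import Algebra.Solver.Ring.NaturalCoefficients.Default commutativeSemiring

  ≈V-sym : ∀ {u v} → u ≈V v → v ≈V u
  ≈V-sym u≈v i = sym (u≈v i)

  ≈V-trans : ∀ {u v w} → u ≈V v → v ≈V w → u ≈V w
  ≈V-trans u≈v v≈w i = trans (u≈v i) (v≈w i)

  ≈V? : ∀ u v → Dec (u ≈V v)
  ≈V? u v = all? (λ i → u i ≟ v i)

  lincomb-cong : ∀ {k} {c d : Fin k → Carrier} (b : Fin k → V) → (∀ j → c j ≡ d j) →
                 lincomb c b ≈V lincomb d b
  lincomb-cong {zero}  b c≗d i = refl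
  lincomb-cong {suc k} b c≗d i =
    cong₂ (λ a L → a *F b fzero i +F L) (c≗d fzero) (lincomb-cong (tail b) (c≗d ∘ fsuc) i)

  lincomb-zero-head : ∀ {k} (c : Fin (suc k) → Carrier) (b : Fin (suc k) → V) → c fzero ≡ 0# →
                      lincomb c b ≈V lincomb (tail c) (tail b)
  lincomb-zero-head c b c₀≡0 i = begin
    c fzero *F b fzero i +F L  ≡⟨ cong (λ a → a *F b fzero i +F L) c₀≡0 ⟩
    0# *F b fzero i +F L       ≡⟨ cong (_+F L) (zeroˡ _) ⟩
    0# +F L                    ≡⟨ +-identityˡ L ⟩
    L                          ∎
    where
    open ≡-Reasoning
    L = lincomb (tail c) (tail b) i

  lincomb-0 : ∀ {k} (b : Fin k → V) → lincomb (λ _ → 0#) b ≈V zeroV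
  lincomb-0 {zero}  b i = refl
  lincomb-0 {suc k} b i = trans (lincomb-zero-head (λ _ → 0#) b refl i) (lincomb-0 (tail b) i)

  lincomb-+ : ∀ {k} (c d : Fin k → Carrier) (b : Fin k → V) →
              lincomb (λ j → c j +F d j) b ≈V (lincomb c b ⊕ lincomb d b)
  lincomb-+ {zero}  c d b i = sym (+-identityʳ 0#)
  lincomb-+ {suc k} c d b i =
    trans (cong ((c fzero +F d fzero) *F b fzero i +F_) (lincomb-+ (tail c) (tail d) (tail b) i))
          (solve 5 (λ c d x L L′ → (c :+ d) :* x :+ (L :+ L′) := c :* x :+ L :+ (d :* x :+ L′))
                 refl (c fzero) (d fzero) (b fzero i) _ _)

  lincomb-* : ∀ {k} (s : Carrier) (c : Fin k → Carrier) (b : Fin k → V) →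
              lincomb (λ j → s *F c j) b ≈V (s · lincomb c b)
  lincomb-* {zero}  s c b i = sym (zeroʳ s)
  lincomb-* {suc k} s c b i =
    trans (cong (s *F c fzero *F b fzero i +F_) (lincomb-* s (tail c) (tail b) i))
          (solve 4 (λ s c x L → s :* c :* x :+ s :* L := s :* (c :* x :+ L)) refl s (c fzero) (b fzero i) _)

  lincomb-punchIn : ∀ {k} (j : Fin (suc k)) (c : Fin (suc k) → Carrier) (b : Fin (suc k) → V) →
                    lincomb c b ≈V ((c j · b j) ⊕ lincomb (c ∘ punchIn j) (b ∘ punchIn j))
  lincomb-punchIn fzero c b i = refl
  lincomb-punchIn {suc k} (fsuc j) c b i =
    trans (cong (c fzero *F b fzero i +F_) (lincomb-punchIn j (tail c) (tail b) i))
          (solve 3 (λ x y L → x :+ (y :+ L) := y :+ (x :+ L)) refl _ _ _)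

  lincomb-shear : ∀ {k} (d : Fin k → Carrier) (f : Fin k → V) (s : Fin k → Carrier) (w : V) →
                  lincomb d (λ t → f t ⊕ (s t · w)) ≈V (lincomb d f ⊕ (sum (λ t → d t *F s t) · w))
  lincomb-shear {zero}  d f s w i = sym (trans (+-identityˡ _) (zeroˡ (w i)))
  lincomb-shear {suc k} d f s w i =
    trans (cong (d fzero *F (f fzero i +F s fzero *F w i) +F_)
                (lincomb-shear (tail d) (tail f) (tail s) w i))
          (solve 6 (λ d f s w L D → d :* (f :+ s :* w) :+ (L :+ D :* w) := d :* f :+ L :+ (d :* s :+ D) :* w)
                 refl (d fzero) (f fzero i) (s fzero) (w i) _ _)

  ∋-lincomb : (A : Subspace) → ∀ {k} (c : Fin k → Carrier) (b : Fin k → V) → (∀ j → A ∋ b j) →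
              A ∋ lincomb c b
  ∋-lincomb A {zero}  c b b∈A = ∋zero A
  ∋-lincomb A {suc k} c b b∈A =
    ∋⊕ A (∋· A (c fzero) (b∈A fzero)) (∋-lincomb A (tail c) (tail b) (b∈A ∘ fsuc))

  span : ∀ {m} → (Fin m → V) → Subspace
  span {m} y = record
    { _∋_    = λ v → Σ (Fin m → Carrier) λ c → v ≈V lincomb c y
    ; ∋?     = λ v → anyVector? m _ (λ c≗d v≈ → ≈V-trans v≈ (lincomb-cong y c≗d))
                                     (λ c → ≈V? v (lincomb c y))
    ; ∋-resp = λ u≈v (c , u≈) → c , ≈V-trans (≈V-sym u≈v) u≈
    ; ∋zero  = (λ _ → 0#) , ≈V-sym (lincomb-0 y)
    ; ∋⊕     = λ (c , u≈) (d , v≈) → (λ j → c j +F d j) ,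
                 λ i → trans (cong₂ _+F_ (u≈ i) (v≈ i)) (sym (lincomb-+ c d y i))
    ; ∋·     = λ s (c , v≈) → (λ j → s *F c j) ,
                 λ i → trans (cong (s *F_) (v≈ i)) (sym (lincomb-* s c y i))
    }

  _∩_ : Subspace → Subspace → Subspace
  A ∩ B = record
    { _∋_    = λ v → A ∋ v × B ∋ v
    ; ∋?     = λ v → ∋? A v ×-dec ∋? B v
    ; ∋-resp = λ u≈v (u∈A , u∈B) → ∋-resp A u≈v u∈A , ∋-resp B u≈v u∈B
    ; ∋zero  = ∋zero A , ∋zero B
    ; ∋⊕     = λ (u∈A , u∈B) (v∈A , v∈B) → ∋⊕ A u∈A v∈A , ∋⊕ B u∈B v∈B
    ; ∋·     = λ s (v∈A , v∈B) → ∋· A s v∈A , ∋· B s v∈B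
    }

  ∈span-tail : ∀ {m} (y : Fin (suc m) → V) {v : V} (c : Fin (suc m) → Carrier) →
               v ≈V lincomb c y → c fzero ≡ 0# → span (tail y) ∋ v
  ∈span-tail y c v≈ c₀≡0 = tail c , ≈V-trans v≈ (lincomb-zero-head c y c₀≡0)

  span≤ : ∀ {k} (A : Subspace) {b : Fin k → V} → (∀ j → A ∋ b j) → span b ≤S A
  span≤ A {b} b∈A v (c , v≈) = ∋-resp A (≈V-sym v≈) (∋-lincomb A c b b∈A)

  Dependent : ∀ {p} → (Fin p → V) → Set
  Dependent {p} u = Σ (Fin p → Carrier) λ d → lincomb d u ≈V zeroV × Σ (Fin p) λ j → d j ≢ 0#

  dependent⇒¬independent : ∀ {p} {u : Fin p → V} → Dependent u → ¬ LinIndep u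
  dependent⇒¬independent (d , d-rel , j , dⱼ≢0) u-indep = dⱼ≢0 (u-indep d d-rel j)

  relation⇒head∈span : ∀ {k} (d : Fin (suc k) → Carrier) (u : Fin (suc k) → V) →
                       lincomb d u ≈V zeroV → d fzero ≢ 0# → span (tail u) ∋ u fzero
  relation⇒head∈span d u d-rel d₀≢0 =
    (λ j → -F γ *F d (fsuc j)) ,
    λ i → trans (ax+t≡0⇒x≡-γt d₀γ≡1 (d-rel i)) (sym (lincomb-* (-F γ) (tail d) (tail u) i))
    where
    γ = proj₁ (inverse (d fzero) d₀≢0)
    d₀γ≡1 = proj₂ (inverse (d fzero) d₀≢0)

  relation-zero-head⇒trivial : ∀ {k} (d : Fin (suc k) → Carrier) (u : Fin (suc k) → V) →
                               LinIndep (tail u) → lincomb d u ≈V zeroV → d fzero ≡ 0# → ∀ j → d j ≡ 0#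
  relation-zero-head⇒trivial d u tail-indep d-rel d₀≡0 fzero    = d₀≡0
  relation-zero-head⇒trivial d u tail-indep d-rel d₀≡0 (fsuc j) =
    tail-indep (tail d) (≈V-trans (≈V-sym (lincomb-zero-head d u d₀≡0)) d-rel) j

  independent-∷ : ∀ {k} {c : V} {g : Fin k → V} → LinIndep g → ¬ span g ∋ c → LinIndep (c ∷ g)
  independent-∷ {c = c} {g} g-indep c∉span a a-rel with a fzero ≟ 0#
  ... | yes a₀≡0 = relation-zero-head⇒trivial a (c ∷ g) g-indep a-rel a₀≡0
  ... | no  a₀≢0 = ⊥-elim (c∉span (relation⇒head∈span a (c ∷ g) a-rel a₀≢0))

  dependent-∷⇒∈span : ∀ {k} {v : V} {u : Fin k → V} → LinIndep u → Dependent (v ∷ u) → span u ∋ v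
  dependent-∷⇒∈span {v = v} {u} u-indep (d , d-rel , j , dⱼ≢0) with d fzero ≟ 0#
  ... | yes d₀≡0 = ⊥-elim (dⱼ≢0 (relation-zero-head⇒trivial d (v ∷ u) u-indep d-rel d₀≡0 j))
  ... | no  d₀≢0 = relation⇒head∈span d (v ∷ u) d-rel d₀≢0

  eliminate-head : ∀ {m} (y : Fin (suc m) → V) (a b : Fin (suc m) → Carrier) {β : Carrier} {v w : V} →
                   b fzero *F β ≡ 1# → v ≈V lincomb a y → w ≈V lincomb b y →
                   span (tail y) ∋ (v ⊕ ((-F (a fzero *F β)) · w))
  eliminate-head y a b {β} {v} {w} b₀β≡1 v≈ w≈ =
    (λ j → a (fsuc j) +F s *F b (fsuc j)) , λ i → begin
      v i +F s *F w i
        ≡⟨ cong₂ (λ v w → v +F s *F w) (v≈ i) (w≈ i) ⟩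
      a fzero *F y fzero i +F A i +F s *F (b fzero *F y fzero i +F B i)
        ≡⟨ solve 6 (λ a b s y A B → a :* y :+ A :+ s :* (b :* y :+ B) := (a :+ s :* b) :* y :+ (A :+ s :* B))
                   refl (a fzero) (b fzero) s (y fzero i) (A i) (B i) ⟩
      (a fzero +F s *F b fzero) *F y fzero i +F (A i +F s *F B i)
        ≡⟨ cong (λ z → z *F y fzero i +F (A i +F s *F B i)) (a-aβb≡0 b₀β≡1) ⟩
      0# *F y fzero i +F (A i +F s *F B i)
        ≡⟨ trans (cong (_+F (A i +F s *F B i)) (zeroˡ _)) (+-identityˡ _) ⟩
      A i +F s *F B i
        ≡⟨ cong (A i +F_) (sym (lincomb-* s (tail b) (tail y) i)) ⟩
      A i +F lincomb (λ j → s *F b (fsuc j)) (tail y) i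
        ≡⟨ sym (lincomb-+ (tail a) (λ j → s *F b (fsuc j)) (tail y) i) ⟩
      lincomb (λ j → a (fsuc j) +F s *F b (fsuc j)) (tail y) i ∎
    where
    open ≡-Reasoning
    s = -F (a fzero *F β)
    A = lincomb (tail a) (tail y)
    B = lincomb (tail b) (tail y)

  dependent-of-shear : ∀ {p} (u : Fin (suc p) → V) (j₀ : Fin (suc p)) (s : Fin p → Carrier) →
                       Dependent (λ t → u (punchIn j₀ t) ⊕ (s t · u j₀)) → Dependent u
  dependent-of-shear u j₀ s (d , d-rel , t , dₜ≢0) =
    d′ , d′-rel , punchIn j₀ t , λ e → dₜ≢0 (trans (sym (insertAt-punchIn d j₀ σ t)) e)
    where
    open ≡-Reasoning
    σ = sum (λ t → d t *F s t)
    d′ = insertAt d j₀ σ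
    d′-rel : lincomb d′ u ≈V zeroV
    d′-rel i = begin
      lincomb d′ u i
        ≡⟨ lincomb-punchIn j₀ d′ u i ⟩
      d′ j₀ *F u j₀ i +F lincomb (d′ ∘ punchIn j₀) (u ∘ punchIn j₀) i
        ≡⟨ cong₂ (λ a L → a *F u j₀ i +F L) (insertAt-lookup d j₀ σ)
                 (lincomb-cong (u ∘ punchIn j₀) (insertAt-punchIn d j₀ σ) i) ⟩
      σ *F u j₀ i +F lincomb d (u ∘ punchIn j₀) i
        ≡⟨ solve 3 (λ σ x L → σ :* x :+ L := L :+ σ :* x) refl σ (u j₀ i) _ ⟩
      lincomb d (u ∘ punchIn j₀) i +F σ *F u j₀ i
        ≡⟨ sym (lincomb-shear d (u ∘ punchIn j₀) s (u j₀) i) ⟩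
      lincomb d (λ t → u (punchIn j₀ t) ⊕ (s t · u j₀)) i
        ≡⟨ d-rel i ⟩
      0# ∎

  steinitz : ∀ m {p} → m < p → (y : Fin m → V) (u : Fin p → V) → (∀ j → span y ∋ u j) → Dependent u
  steinitz zero {suc p} _ y u u∈span =
    (1# ∷ λ _ → 0#) , u-rel , fzero , λ 1≡0 → 0≢1 (sym 1≡0)
    where
    u-rel : lincomb (1# ∷ λ _ → 0#) u ≈V zeroV
    u-rel i = trans (cong₂ (λ x L → 1# *F x +F L) (proj₂ (u∈span fzero) i) (lincomb-0 (tail u) i))
                    (trans (+-identityʳ _) (zeroʳ 1#))
  steinitz (suc m) (s≤s m<p) y u u∈span with all? (λ j → proj₁ (u∈span j) fzero ≟ 0#)
  ... | yes heads≡0 =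
    steinitz m (m<n⇒m<1+n m<p) (tail y) u λ j →
      ∈span-tail y (proj₁ (u∈span j)) (proj₂ (u∈span j)) (heads≡0 j)
  -- Pivot on a nonzero head coefficient: subtracting multiples of u j₀ clears the others.
  ... | no ¬heads≡0 = dependent-of-shear u j₀ s (steinitz m m<p (tail y) _ sheared∈span)
    where
    coeff = λ j → proj₁ (u∈span j)
    pivot = ¬∀⟶∃¬ _ _ (λ j → coeff j fzero ≟ 0#) ¬heads≡0
    j₀ = proj₁ pivot
    β = proj₁ (inverse _ (proj₂ pivot))
    αβ≡1 = proj₂ (inverse _ (proj₂ pivot))
    s = λ t → -F (coeff (punchIn j₀ t) fzero *F β)

    sheared∈span : ∀ t → span (tail y) ∋ (u (punchIn j₀ t) ⊕ (s t · u j₀))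
    sheared∈span t = eliminate-head y (coeff (punchIn j₀ t)) (coeff j₀) αβ≡1
                                    (proj₂ (u∈span (punchIn j₀ t))) (proj₂ (u∈span j₀))

  _≤S⟨_⟩+_ : Subspace → V → Subspace → Set
  C ≤S⟨ c ⟩+ B = ∀ v → C ∋ v → Σ Carrier λ a → Σ V λ b → B ∋ b × v ≈V ((a · c) ⊕ b)

  ∷-basis : ∀ {k} (C B : Subspace) {c : V} {g : Fin k → V} → C ∋ c → ¬ B ∋ c → C ≤S⟨ c ⟩+ B →
            IsBasis (C ∩ B) g → IsBasis C (c ∷ g)
  ∷-basis C B {c} {g} c∈C c∉B C≤⟨c⟩+B (g∈C∩B , g-indep , C∩B≤span) =
    c∷g∈C , independent-∷ g-indep (c∉B ∘ span≤ B (proj₂ ∘ g∈C∩B) c) , C≤span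
    where
    c∷g∈C : ∀ j → C ∋ (c ∷ g) j
    c∷g∈C fzero    = c∈C
    c∷g∈C (fsuc j) = proj₁ (g∈C∩B j)

    C≤span : C ≤S span (c ∷ g)
    C≤span v v∈C with C≤⟨c⟩+B v v∈C
    ... | a , b , b∈B , v≈ac+b =
      a ∷ proj₁ b∈span , λ i → trans (v≈ac+b i) (cong (a *F c i +F_) (proj₂ b∈span i))
      where
      b∈C : C ∋ b
      b∈C = ∋-resp C (λ i → sym (x≡yz+w⇒w≡x-yz (v≈ac+b i))) (∋⊕ C v∈C (∋· C (-F a) c∈C))
      b∈span = C∩B≤span b (b∈C , b∈B)

  ≤S⟨pivot⟩+span-tail : ∀ {m} (y : Fin (suc m) → V) (W : Subspace) {w : V} → W ≤S span y →
                        W ∋ w → ¬ span (tail y) ∋ w → W ≤S⟨ w ⟩+ span (tail y)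
  ≤S⟨pivot⟩+span-tail y W {w} W≤span w∈W w∉span v v∈W =
    μ , (v ⊕ ((-F μ) · w)) , eliminate-head y a c c₀γ≡1 v≈ w≈ , λ i → x≡yz+[x-yz] (v i) μ (w i)
    where
    a = proj₁ (W≤span v v∈W)
    v≈ = proj₂ (W≤span v v∈W)
    c = proj₁ (W≤span w w∈W)
    w≈ = proj₂ (W≤span w w∈W)
    c₀≢0 : c fzero ≢ 0#
    c₀≢0 = w∉span ∘ ∈span-tail y c w≈
    c₀γ≡1 = proj₂ (inverse _ c₀≢0)
    μ = a fzero *F proj₁ (inverse _ c₀≢0)

  basis-of-≤span : ∀ m (y : Fin m → V) (W : Subspace) → W ≤S span y → Σ ℕ (HasDim W)
  basis-of-≤span zero y W W≤span = zero , (λ ()) , (λ ()) , (λ _ _ ()) , W≤span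
  basis-of-≤span (suc m) y W W≤span
    with anyVector? n (λ v → W ∋ v × ¬ span (tail y) ∋ v)
           (λ u≈v (u∈W , u∉span) → ∋-resp W u≈v u∈W , u∉span ∘ ∋-resp (span (tail y)) (≈V-sym u≈v))
           (λ v → ∋? W v ×-dec ¬? (∋? (span (tail y)) v))
  ... | no ∄w = basis-of-≤span m (tail y) W λ v v∈W →
                  decidable-stable (∋? (span (tail y)) v) λ v∉span → ∄w (v , v∈W , v∉span)
  ... | yes (w , w∈W , w∉span) with basis-of-≤span m (tail y) (W ∩ span (tail y)) (λ _ → proj₂)
  ...   | k , b , b-basis =
    suc k , w ∷ b ,
    ∷-basis W (span (tail y)) w∈W w∉span (≤S⟨pivot⟩+span-tail y W W≤span w∈W w∉span) b-basis

  -- k + 2 vectors v, c, h₁, …, h_k of S are dependent, and c ∷ h is independent.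
  codim₁-complement : ∀ {k} (S B : Subspace) {c : V} (x : Fin (suc k) → V) {h : Fin k → V} →
                      S ≤S span x → IsBasis B h → B ≤S S → S ∋ c → ¬ B ∋ c → S ≤S⟨ c ⟩+ B
  codim₁-complement {k} S B {c} x {h} S≤span (h∈B , h-indep , _) B≤S c∈S c∉B v v∈S =
    proj₁ v∈span fzero , lincomb (tail (proj₁ v∈span)) h , ∋-lincomb B _ h h∈B , proj₂ v∈span
    where
    v∷c∷h≤span : ∀ j → span x ∋ (v ∷ c ∷ h) j
    v∷c∷h≤span fzero           = S≤span v v∈S
    v∷c∷h≤span (fsuc fzero)    = S≤span c c∈S
    v∷c∷h≤span (fsuc (fsuc j)) = S≤span (h j) (B≤S (h j) (h∈B j))

    v∈span : span (c ∷ h) ∋ v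
    v∈span = dependent-∷⇒∈span {v = v} {c ∷ h}
               (independent-∷ {c = c} h-indep (c∉B ∘ span≤ B h∈B c))
               (steinitz (suc k) (n<1+n (suc k)) x (v ∷ c ∷ h) v∷c∷h≤span)

  independent⇒∃∉ : ∀ {k} (B : Subspace) (x : Fin (suc k) → V) {h : Fin k → V} → LinIndep x →
                   B ≤S span h → Σ (Fin (suc k)) λ j → ¬ B ∋ x j
  independent⇒∃∉ {k} B x {h} x-indep B≤span with all? (λ j → ∋? B (x j))
  ... | yes x∈B = ⊥-elim (dependent⇒¬independent {u = x}
                            (steinitz k (n<1+n k) h x λ j → B≤span (x j) (x∈B j)) x-indep)
  ... | no ¬x∈B = ¬∀⟶∃¬ _ _ (λ j → ∋? B (x j)) ¬x∈B

  single : ∀ {ℓ} → Fin ℓ → V → Fin ℓ → V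
  single fzero    v fzero    = v
  single fzero    v (fsuc j) = zeroV
  single (fsuc i) v fzero    = zeroV
  single (fsuc i) v (fsuc j) = single i v j

  ∋-single : ∀ {ℓ} (C : Fin ℓ → Subspace) {i : Fin ℓ} {v : V} → C i ∋ v → ∀ j → C j ∋ single i v j
  ∋-single C {fzero}  v∈Cᵢ fzero    = v∈Cᵢ
  ∋-single C {fzero}  v∈Cᵢ (fsuc j) = ∋zero (C (fsuc j))
  ∋-single C {fsuc i} v∈Cᵢ fzero    = ∋zero (C fzero)
  ∋-single C {fsuc i} v∈Cᵢ (fsuc j) = ∋-single (tail C) v∈Cᵢ j

  sumV-zeroV : ∀ {ℓ} → sumV {ℓ} (λ _ → zeroV) ≈V zeroV
  sumV-zeroV {zero}  i = refl
  sumV-zeroV {suc ℓ} i = trans (cong (0# +F_) (sumV-zeroV {ℓ} i)) (+-identityˡ 0#)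

  sumV-single : ∀ {ℓ} (i : Fin ℓ) (v : V) → sumV (single i v) ≈V v
  sumV-single {suc ℓ} fzero    v t = trans (cong (v t +F_) (sumV-zeroV {ℓ} t)) (+-identityʳ (v t))
  sumV-single         (fsuc i) v t = trans (+-identityˡ _) (sumV-single i v t)

  summand≤sum : ∀ {ℓ} (S : Subspace) (C : Fin ℓ → Subspace) → IsSum S C → ∀ i → C i ≤S S
  summand≤sum S C S≡ΣC i v v∈Cᵢ =
    Equivalence.from (S≡ΣC v) (single i v , ∋-single C v∈Cᵢ , ≈V-sym (sumV-single i v))

  ∋-sumV : ∀ (A : Subspace) {ℓ} (w : Fin ℓ → V) → (∀ j → A ∋ w j) → A ∋ sumV w
  ∋-sumV A {zero}  w w∈A = ∋zero A
  ∋-sumV A {suc ℓ} w w∈A = ∋⊕ A (w∈A fzero) (∋-sumV A (tail w) (w∈A ∘ fsuc))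

  summand∉ : ∀ {ℓ} (S B : Subspace) (C : Fin ℓ → Subspace) {v : V} → IsSum S C → S ∋ v → ¬ B ∋ v →
             Σ (Fin ℓ) λ i → Σ V λ c → C i ∋ c × ¬ B ∋ c
  summand∉ S B C {v} S≡ΣC v∈S v∉B with Equivalence.to (S≡ΣC v) v∈S
  ... | w , w∈C , v≈Σw with all? (λ i → ∋? B (w i))
  ...   | yes w∈B = ⊥-elim (v∉B (∋-resp B (≈V-sym v≈Σw) (∋-sumV B w w∈B)))
  ...   | no ¬w∈B =
    let (i , wᵢ∉B) = ¬∀⟶∃¬ _ _ (λ i → ∋? B (w i)) ¬w∈B in i , w i , w∈C i , wᵢ∉B

module QMatroidRank {q : ℕ} (𝔽 : FiniteField q) (n : ℕ) (M : Space.QMatroid 𝔽 n) where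
  open Space 𝔽 n
  open QMatroid M
  open LinearAlgebra 𝔽 n

  r-absorb : ∀ (A C S I : Subspace) → IsSum₂ S A C → IsMeet I A C → r I ≡ r A → r S ≤ r C
  r-absorb A C S I S≡A+C I≡A∩C rI≡rA = +-cancelˡ-≤ (r A) (r S) (r C) (begin
    r A + r S  ≡⟨ +-comm (r A) (r S) ⟩
    r S + r A  ≡⟨ cong (r S +_) (sym rI≡rA) ⟩
    r S + r I  ≤⟨ R3 A C S I S≡A+C I≡A∩C ⟩
    r A + r C  ∎)
    where open ≤-Reasoning

  -- C ∩ B is a hyperplane of C, and S = C + B.
  cyclic⊈hyperplane⇒r≡ : ∀ {k} (C S B : Subspace) (x : Fin (suc k) → V) {h : Fin k → V} {c : V} →
                         Cyclic M C → C ≤S S → B ≤S S → S ≤S span x → IsBasis B h →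
                         C ∋ c → ¬ B ∋ c → r B ≡ r S
  cyclic⊈hyperplane⇒r≡ {k} C S B x {h} {c} C-cyclic C≤S B≤S S≤span h-basis c∈C c∉B =
    ≤-antisym (R2 B S B≤S) (r-absorb C B S (C ∩ B) S≡C+B (λ _ → mk⇔ id id) rC∩B≡rC)
    where
    S≤⟨c⟩+B = codim₁-complement S B x S≤span h-basis B≤S (C≤S c c∈C) c∉B
    C∩B-basis = basis-of-≤span (suc k) x (C ∩ B) λ v (_ , v∈B) → S≤span v (B≤S v v∈B)
    g = proj₁ (proj₂ C∩B-basis)
    g-basis = proj₂ (proj₂ C∩B-basis)

    rC∩B≡rC : r (C ∩ B) ≡ r C
    rC∩B≡rC = C-cyclic (C ∩ B) (λ _ → proj₁) (proj₁ C∩B-basis)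
                (c ∷ g , ∷-basis C B c∈C c∉B (λ v v∈C → S≤⟨c⟩+B v (C≤S v v∈C)) g-basis) (g , g-basis)

    S≡C+B : IsSum₂ S C B
    S≡C+B v =
      mk⇔ (λ v∈S → let (a , b , b∈B , v≈) = S≤⟨c⟩+B v v∈S in a · c , b , ∋· C a c∈C , b∈B , v≈)
          (λ (u , b , u∈C , b∈B , v≈) → ∋-resp S (≈V-sym v≈) (∋⊕ S (C≤S u u∈C) (B≤S b b∈B)))

lemma2p10 : (q : ℕ) → IsPrimePower q → (𝔽 : FiniteField q) → (n : ℕ) →
    let open Space 𝔽 n in
    (M : QMatroid) → (ℓ : ℕ) → (C : Fin ℓ → Subspace) →
    (∀ i → Cyclic M (C i)) →
    (S : Subspace) → IsSum S C → Cyclic M S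
lemma2p10 _ _ 𝔽 n M _ C C-cyclic S S≡ΣC B B≤S k (x , x∈S , x-indep , S≤span-x) (h , h-basis) =
  let (j , xⱼ∉B)            = independent⇒∃∉ B x x-indep (proj₂ (proj₂ h-basis))
      (i , c , c∈Cᵢ , c∉B) = summand∉ S B C S≡ΣC (x∈S j) xⱼ∉B
  in  cyclic⊈hyperplane⇒r≡ (C i) S B x (C-cyclic i) (summand≤sum S C S≡ΣC i) B≤S S≤span-x h-basis
        c∈Cᵢ c∉B
  where
  open LinearAlgebra 𝔽 n
  open QMatroidRank 𝔽 n M
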